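{- Let $H$ be a hypergraph that contains at least one edge, let $\mathcal{G}$ be the class of all hypergraphs, and let $f:\mathcal{G}\to\mathbb{N}$ be one of the functions $G\mapsto\#\mathrm{TrimHom}(H,G)$, $G\mapsto\#\mathrm{TrimSub}(H,G)$, $G\mapsto\#\mathrm{IndTrimSub}(H,G)$. Then there is no finitely supported function $\gamma$ from hypergraphs to $\mathbb{Q}$ such that $f(G)=\sum_{F\in\mathcal{G}}\gamma(F)\cdot\#\mathrm{Hom}(F,G)$ holds for all $G\in\mathcal{G}$.
   Context: A hypergraph is a pair $H=(V,E)$ with $V$ finite and $E\subseteq2^V\setminus\{\varnothing\}$; sums over $\mathcal{G}$ range over isomorphism types. A homomorphism from $F$ to $G$ is a map $\varphi:V(F)\to V(G)$ with $\varphi(e)\in E(G)$ for all $e\in E(F)$; $\mathrm{Hom}(F,G)$ is the set of these. A trimmed homomorphism is a map $\varphi:V(H)\to V(G)$ such that for every $e\in E(H)$ there is $e'\in E(G)$ with $\varphi(e)=e'\cap\mathrm{img}(\varphi)$; $\mathrm{TrimHom}(H,G)$ is their set. A trimmed sub-hypergraph of $G$ is a hypergraph $G'$ with $V(G')\subseteq V(G)$ such that every $e'\in E(G')$ equals $e\cap V(G')$ for some $e\in E(G)$; $\mathrm{TrimSub}(H,G)$ is the set of trimmed sub-hypergraphs of $G$ isomorphic to $H$. For $X\subseteq V(G)$, $G|_X:=(X,\{e\cap X:e\in E(G),e\cap X\ne\varnothing\})$; $\mathrm{IndTrimSub}(H,G)$ is the set of such induced trimmed sub-hypergraphs of $G$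 isomorphic to $H$. -}

module Defs where

open import Data.Bool using (Bool; true; false)
import Data.Bool.Properties as BoolP
open import Data.Nat using (ℕ; zero; suc)
open import Data.Integer using (+_)
open import Data.Rational using (ℚ; _/_; _+_; _*_; 0ℚ)
open import Data.Fin using (Fin)
open import Data.Fin.Properties using (any?; all?) renaming (_≟_ to _≟ᶠ_)
open import Data.Fin.Subset using (Subset; ⊤; _∩_; Nonempty; _∈_)
open import Data.Fin.Subset.Properties using (_∈?_; nonempty?)
open import Data.Vec using (Vec; []; _∷_; tabulate; lookup)
open import Data.Vec.Properties using (≡-dec)
open import Data.List using (List; []; _∷_; map; concatMap; filter; allFin; foldr; length; deduplicate; _++_)
open import Data.List.Relation.Unary.All using (All)
import Data.List.Relation.Unary.All as All
open import Data.List.Relation.Unary.Any using (Any)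
import Data.List.Relation.Unary.Any as Any
open import Data.List.Relation.Unary.Unique.Propositional using (Unique)
open import Data.List.Membership.Propositional using () renaming (_∈_ to _∈ₗ_)
open import Data.List.Membership.DecPropositional using () renaming (_∈?_ to ∈ₗ?)
open import Data.Product using (Σ; _×_; _,_; ∃; proj₁; proj₂)
open import Relation.Nullary using (Dec; yes; no; does; ¬_)
open import Relation.Nullary.Decidable using (_×-dec_; ¬?; _→-dec_)
open import Relation.Binary.PropositionalEquality using (_≡_)

-- Hypergraphs.  Vertex set Fin n; edge set = a duplicate-free list of
-- nonempty subsets of Fin n (Subset n = Vec Bool n).  Hence E ⊆ 2^V ∖ {∅}.

record Hypergraph : Set where
  field
    n        : ℕ
    edges    : List (Subset n)
    unique   : Unique edges
    nonempty : All Nonempty edges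
open Hypergraph public

_≟ˢ_ : ∀ {n} (p q : Subset n) → Dec (p ≡ q)
_≟ˢ_ = ≡-dec BoolP._≟_

_∈ᴱ?_ : ∀ {n} (p : Subset n) (es : List (Subset n)) → Dec (p ∈ₗ es)
p ∈ᴱ? es = ∈ₗ? _≟ˢ_ p es

Map : ℕ → ℕ → Set
Map m k = Vec (Fin k) m

allFins : (k : ℕ) → List (Fin k)
allFins k = allFin k

allMaps : (m k : ℕ) → List (Map m k)
allMaps zero    k = [] ∷ []
allMaps (suc m) k = concatMap (λ i → map (i ∷_) (allMaps m k)) (allFins k)

image : ∀ {m k} → Map m k → Subset m → Subset k
image {m} φ e = tabulate λ j → does (any? (λ i → (i ∈? e) ×-dec (lookup φ i ≟ᶠ j)))

img : ∀ {m k} → Map m k → Subset k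
img φ = image φ ⊤

Injective : ∀ {m k} → Map m k → Set
Injective {m} φ = ∀ (i j : Fin m) → lookup φ i ≡ lookup φ j → i ≡ j

injective? : ∀ {m k} (φ : Map m k) → Dec (Injective φ)
injective? φ = all? λ i → all? λ j → (lookup φ i ≟ᶠ lookup φ j) →-dec (i ≟ᶠ j)

allSubsets : (n : ℕ) → List (Subset n)
allSubsets zero    = [] ∷ []
allSubsets (suc n) = map (true ∷_) (allSubsets n) ++ map (false ∷_) (allSubsets n)

sublists : ∀ {A : Set} → List A → List (List A)
sublists []       = [] ∷ []
sublists (x ∷ xs) = map (x ∷_) (sublists xs) ++ sublists xs

IsHom : (F G : Hypergraph) → Map (n F) (n G) → Set
IsHom F G φ = All (λ e → image φ e ∈ₗ edges G) (edges F)

isHom? : (F G : Hypergraph) (φ : Map (n F) (n G)) → Dec (IsHom F G φ)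
isHom? F G φ = All.all? (λ e → image φ e ∈ᴱ? edges G) (edges F)

#Hom : Hypergraph → Hypergraph → ℕ
#Hom F G = length (filter (isHom? F G) (allMaps (n F) (n G)))

IsTrimHom : (H G : Hypergraph) → Map (n H) (n G) → Set
IsTrimHom H G φ = All (λ e → Any (λ e' → image φ e ≡ e' ∩ img φ) (edges G)) (edges H)

isTrimHom? : (H G : Hypergraph) (φ : Map (n H) (n G)) → Dec (IsTrimHom H G φ)
isTrimHom? H G φ = All.all? (λ e → Any.any? (λ e' → image φ e ≟ˢ (e' ∩ img φ)) (edges G)) (edges H)

#TrimHom : Hypergraph → Hypergraph → ℕ
#TrimHom H G = length (filter (isTrimHom? H G) (allMaps (n H) (n G)))

-- A trimmed sub-hypergraph is a pair
-- (X, E') with X ⊆ V(G) and E' a set of sets of the form e ∩ X (e ∈ E(G)),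
-- each nonempty (edges of a hypergraph are nonempty).
-- traces G X = the set {e ∩ X : e ∈ E(G), e ∩ X ≠ ∅}, i.e. E(G|_X).

traces : (G : Hypergraph) → Subset (n G) → List (Subset (n G))
traces G X = deduplicate _≟ˢ_ (filter nonempty? (map (_∩ X) (edges G)))

IsoTo : (H G : Hypergraph) → Subset (n G) → List (Subset (n G)) → Map (n H) (n G) → Set
IsoTo H G X E' ψ =
  Injective ψ × (img ψ ≡ X)
  × All (λ e → image ψ e ∈ₗ E') (edges H)
  × All (λ e' → Any (λ e → image ψ e ≡ e') (edges H)) E'

isoTo? : (H G : Hypergraph) (X : Subset (n G)) (E' : List (Subset (n G)))
         (ψ : Map (n H) (n G)) → Dec (IsoTo H G X E' ψ)
isoTo? H G X E' ψ =
  injective? ψ ×-dec (img ψ ≟ˢ X)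
  ×-dec All.all? (λ e → image ψ e ∈ᴱ? E') (edges H)
  ×-dec All.all? (λ e' → Any.any? (λ e → image ψ e ≟ˢ e') (edges H)) E'

isomorphic? : (H G : Hypergraph) (X : Subset (n G)) (E' : List (Subset (n G))) →
              Dec (Any (IsoTo H G X E') (allMaps (n H) (n G)))
isomorphic? H G X E' = Any.any? (isoTo? H G X E') (allMaps (n H) (n G))

-- all trimmed sub-hypergraphs of G (each exactly once)
trimSubs : (G : Hypergraph) → List (Subset (n G) × List (Subset (n G)))
trimSubs G = concatMap (λ X → map (X ,_) (sublists (traces G X))) (allSubsets (n G))

#TrimSub : Hypergraph → Hypergraph → ℕ
#TrimSub H G = length (filter (λ XE → isomorphic? H G (proj₁ XE) (proj₂ XE)) (trimSubs G))

#IndTrimSub : Hypergraph → Hypergraph → ℕ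
#IndTrimSub H G = length (filter (λ X → isomorphic? H G X (traces G X)) (allSubsets (n G)))

data Kind : Set where
  trimHom trimSub indTrimSub : Kind

count : Kind → Hypergraph → Hypergraph → ℕ
count trimHom    = #TrimHom
count trimSub    = #TrimSub
count indTrimSub = #IndTrimSub

-- Finitely supported γ : hypergraphs → ℚ, given as a finite list of
-- (F , γ(F)) pairs; Σ_F γ(F) · #Hom(F, G).

toℚ : ℕ → ℚ
toℚ k = (+ k) / 1

homSum : List (Hypergraph × ℚ) → Hypergraph → ℚ
homSum γ G = foldr (λ Fq acc → (proj₂ Fq * toℚ (#Hom (proj₁ Fq) G)) + acc) 0ℚ γ

{-# OPTIONS --safe #-}
-- Choose M larger than the number of vertices of every F in the support of γ, and enlarge
-- every edge of H by the same M new vertices. No map from such an F can send an edge onto an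
-- enlarged edge, so on this padded hypergraph #Hom(F, -) takes the same value as on the
-- edgeless hypergraph with the same vertices (all maps if F has no edges, none otherwise),
-- and hence so does Σ γ(F) #Hom(F, -). But the old vertices induce a copy of H in the padded
-- hypergraph, so all three counts are positive there, while they vanish on the edgeless one
-- because H has an edge.
module Submission where

open import Defs
open import Data.List using ([])
open import Data.Product using (Σ; _×_)
open import Data.Rational using (ℚ)
open import Data.List using (List)
open import Relation.Nullary using (¬_)
open import Relation.Binary.PropositionalEquality using (_≡_; _≢_)

open import Data.Bool using (true; false)
open import Data.Nat using (ℕ; zero; suc; _+_; _<_; _≤_; _⊔_)
open import Data.Nat.Properties using (<-≤-trans; <⇒≢; <⇒≱; m≤m⊔n; m≤n⊔m)
open import Data.Nat.Coprimality using (1-coprimeTo) renaming (sym to coprime-sym)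
import Data.Integer as ℤ
import Data.Integer.Properties as ℤ
import Data.Rational as ℚ
open import Data.Rational.Properties using (normalize-coprime)
open import Data.Fin using (Fin; _↑ˡ_; _↑ʳ_)
open import Data.Fin.Properties using (any?; injective⇒≤; ↑ˡ-injective; ↑ʳ-injective)
open import Data.Fin.Subset using (Subset; _∩_; _⊆_; Nonempty; _∈_)
open import Data.Fin.Subset.Properties using (nonempty?; ∈⊤; ⊆-antisym; p∩q⊆p; p∩q⊆q; x∈p∩q⁺)
open import Data.Vec using ([]; _∷_; _++_; replicate; lookup; tabulate)
open import Data.Vec.Properties using (lookup∘tabulate; lookup-++ˡ; lookup-++ʳ; lookup-replicate; lookup⇒[]=; []=⇒lookup; ++-injectiveˡ)
open import Data.List using (_∷_; map; length)
open import Data.List.Properties using (filter-some; filter-none; filter-≐)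
open import Data.List.Relation.Unary.All using (All; []; _∷_)
import Data.List.Relation.Unary.All as All
import Data.List.Relation.Unary.All.Properties as All
open import Data.List.Relation.Unary.Any using (Any; here)
import Data.List.Relation.Unary.Any as Any
open import Data.List.Relation.Unary.AllPairs using ([])
import Data.List.Relation.Unary.Unique.Propositional.Properties as Unique
open import Data.List.Membership.Propositional using (lose) renaming (_∈_ to _∈ₗ_)
open import Data.List.Membership.Propositional.Properties
  using (∈-map⁺; ∈-map⁻; ∈-concatMap⁺; ∈-filter⁺; ∈-filter⁻; ∈-deduplicate⁺; ∈-deduplicate⁻; ∈-++⁺ˡ; ∈-++⁺ʳ; ∈-allFin)
open import Data.Product using (∃; _,_; proj₁; proj₂)
open import Data.Empty using (⊥-elim)
open import Relation.Nullary using (Dec; yes; no; does)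
open import Function using (_∘_)
open import Relation.Unary using (_≐_)
import Function.Definitions as Fun
open import Relation.Nullary.Decidable using (dec-true)
open import Relation.Binary.PropositionalEquality using (refl; sym; trans; cong; cong₂; subst; module ≡-Reasoning)

private
  variable
    a m k M : ℕ

All-unsatisfiable⇒[] : ∀ {A : Set} {P : A → Set} {xs : List A} → (∀ x → ¬ P x) → All P xs → xs ≡ []
All-unsatisfiable⇒[] ¬P []      = refl
All-unsatisfiable⇒[] ¬P (p ∷ _) = ⊥-elim (¬P _ p)

strictUpperBound : ∀ {A : Set} (f : A → ℕ) (xs : List A) → ∃ λ B → All (λ x → f x < B) xs
strictUpperBound f []       = 0 , []
strictUpperBound f (x ∷ xs) with B , fxs<B ← strictUpperBound f xs =
  suc (f x) ⊔ B , m≤m⊔n (suc (f x)) B ∷ All.map (λ fy<B → <-≤-trans fy<B (m≤n⊔m (suc (f x)) B)) fxs<B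

↥-toℚ : ∀ c → ℚ.↥ toℚ c ≡ ℤ.+ c
↥-toℚ c = cong ℚ.↥_ (normalize-coprime (coprime-sym (1-coprimeTo c)))

toℚ-injective : ∀ {c d} → toℚ c ≡ toℚ d → c ≡ d
toℚ-injective {c} {d} eq = ℤ.+-injective (trans (sym (↥-toℚ c)) (trans (cong ℚ.↥_ eq) (↥-toℚ d)))

∈-allMaps : (φ : Map m k) → φ ∈ₗ allMaps m k
∈-allMaps {zero}  []      = here refl
∈-allMaps {suc m} (i ∷ φ) = ∈-concatMap⁺ _ (lose (∈-allFin i) (∈-map⁺ (i ∷_) (∈-allMaps φ)))

∈-allSubsets : (p : Subset m) → p ∈ₗ allSubsets m
∈-allSubsets []          = here refl
∈-allSubsets (true  ∷ p) = ∈-++⁺ˡ (∈-map⁺ (true ∷_) (∈-allSubsets p))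
∈-allSubsets (false ∷ p) = ∈-++⁺ʳ _ (∈-map⁺ (false ∷_) (∈-allSubsets p))

self∈sublists : ∀ {A : Set} (xs : List A) → xs ∈ₗ sublists xs
self∈sublists []       = here refl
self∈sublists (x ∷ xs) = ∈-++⁺ˡ (∈-map⁺ (x ∷_) (self∈sublists xs))

dec-true⁻ : ∀ {P : Set} (P? : Dec P) → does P? ≡ true → P
dec-true⁻ (yes p) _  = p
dec-true⁻ (no _)  ()

∈-image⁺ : (φ : Map m k) {e : Subset m} {i : Fin m} → i ∈ e → lookup φ i ∈ image φ e
∈-image⁺ φ {e} {i} i∈e = lookup⇒[]= (lookup φ i) (image φ e)
  (trans (lookup∘tabulate _ (lookup φ i)) (dec-true (any? _) (i , i∈e , refl)))

∈-image⁻ : (φ : Map m k) {e : Subset m} {j : Fin k} → j ∈ image φ e → ∃ λ i → i ∈ e × lookup φ i ≡ j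
∈-image⁻ φ {e} {j} j∈ = dec-true⁻ (any? _) (trans (sym (lookup∘tabulate _ j)) ([]=⇒lookup j∈))

image-nonempty : (φ : Map m k) {e : Subset m} → Nonempty e → Nonempty (image φ e)
image-nonempty φ (i , i∈e) = lookup φ i , ∈-image⁺ φ i∈e

injection-into-image⇒≤ : (φ : Map m k) (e : Subset m) {ι : Fin M → Fin k} →
  Fun.Injective _≡_ _≡_ ι → (∀ x → ι x ∈ image φ e) → M ≤ m
injection-into-image⇒≤ φ e {ι} ι-injective covered = injective⇒≤ preimage-injective
  where
  preimage : ∀ x → ∃ λ i → i ∈ e × lookup φ i ≡ ι x
  preimage x = ∈-image⁻ φ (covered x)
  preimage-injective : Fun.Injective _≡_ _≡_ (proj₁ ∘ preimage)
  preimage-injective {x} {y} eq = ι-injective (begin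
    ι x                            ≡⟨ proj₂ (proj₂ (preimage x)) ⟨
    lookup φ (proj₁ (preimage x))  ≡⟨ cong (lookup φ) eq ⟩
    lookup φ (proj₁ (preimage y))  ≡⟨ proj₂ (proj₂ (preimage y)) ⟩
    ι y                            ∎)
    where open ≡-Reasoning

↑ˡ∈++⁺ : {p : Subset a} (q : Subset M) {i : Fin a} → i ∈ p → i ↑ˡ M ∈ p ++ q
↑ˡ∈++⁺ {p = p} q {i} i∈p = lookup⇒[]= (i ↑ˡ _) (p ++ q) (trans (lookup-++ˡ p q i) ([]=⇒lookup i∈p))

↑ˡ∈++⁻ : (p : Subset a) (q : Subset M) {i : Fin a} → i ↑ˡ M ∈ p ++ q → i ∈ p
↑ˡ∈++⁻ p q {i} i∈ = lookup⇒[]= i p (trans (sym (lookup-++ˡ p q i)) ([]=⇒lookup i∈))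

pad : ∀ M → Subset a → Subset (a + M)
pad M e = e ++ replicate M true

↑ʳ∈pad : ∀ M (e : Subset a) (x : Fin M) → a ↑ʳ x ∈ pad M e
↑ʳ∈pad M e x = lookup⇒[]= _ (pad M e) (trans (lookup-++ʳ e _ x) (lookup-replicate x true))

image≢pad : (φ : Map m (a + M)) (e : Subset m) (e₀ : Subset a) → m < M → image φ e ≢ pad M e₀
image≢pad {a = a} φ e e₀ m<M φe≡pad = <⇒≱ m<M
  (injection-into-image⇒≤ φ e (λ {x} {y} → ↑ʳ-injective a x y)
    (λ x → subst (a ↑ʳ x ∈_) (sym φe≡pad) (↑ʳ∈pad _ e₀ x)))

inclusion : ∀ a M → Map a (a + M)
inclusion a M = tabulate (_↑ˡ M)

lookup-inclusion : (i : Fin a) → lookup (inclusion a M) i ≡ i ↑ˡ M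
lookup-inclusion i = lookup∘tabulate _ i

inclusion-injective : Injective (inclusion a M)
inclusion-injective {M = M} i j eq =
  ↑ˡ-injective M i j (trans (sym (lookup-inclusion i)) (trans eq (lookup-inclusion j)))

pad∩img≡image : ∀ M (e : Subset a) → pad M e ∩ img (inclusion a M) ≡ image (inclusion a M) e
pad∩img≡image {a} M e = ⊆-antisym trace⊆image image⊆trace
  where
  ι = inclusion a M
  trace⊆image : pad M e ∩ img ι ⊆ image ι e
  trace⊆image x∈ with i , _ , refl ← ∈-image⁻ ι (p∩q⊆q (pad M e) (img ι) x∈) =
    ∈-image⁺ ι (↑ˡ∈++⁻ e _ (subst (_∈ pad M e) (lookup-inclusion i) (p∩q⊆p _ _ x∈)))
  image⊆trace : image ι e ⊆ pad M e ∩ img ι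
  image⊆trace x∈ with i , i∈e , refl ← ∈-image⁻ ι x∈ =
    x∈p∩q⁺ (subst (_∈ pad M e) (sym (lookup-inclusion i)) (↑ˡ∈++⁺ _ i∈e) , ∈-image⁺ ι ∈⊤)

edgeless : ℕ → Hypergraph
edgeless b = record { n = b ; edges = [] ; unique = [] ; nonempty = [] }

padded : Hypergraph → ℕ → Hypergraph
padded H M = record
  { n        = n H + M
  ; edges    = map (pad M) (edges H)
  ; unique   = Unique.map⁺ (++-injectiveˡ _ _) (unique H)
  ; nonempty = All.map⁺ (All.map pad-nonempty (nonempty H))
  }
  where
  pad-nonempty : ∀ {e : Subset (n H)} → Nonempty e → Nonempty (pad M e)
  pad-nonempty (i , i∈e) = i ↑ˡ M , ↑ˡ∈++⁺ _ i∈e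

IsHom-edgeless⇒noEdges : ∀ F {b} (φ : Map (n F) b) → IsHom F (edgeless b) φ → edges F ≡ []
IsHom-edgeless⇒noEdges F φ = All-unsatisfiable⇒[] (λ _ ())

IsHom-padded⇒noEdges : ∀ F H {M} (φ : Map (n F) (n H + M)) → n F < M → IsHom F (padded H M) φ → edges F ≡ []
IsHom-padded⇒noEdges F H φ nF<M = All-unsatisfiable⇒[] λ e φe∈ →
  let e₀ , _ , φe≡pad = ∈-map⁻ (pad _) φe∈ in image≢pad φ e e₀ nF<M φe≡pad

noEdges⇒IsHom : ∀ F G (φ : Map (n F) (n G)) → edges F ≡ [] → IsHom F G φ
noEdges⇒IsHom F G φ noEdges = subst (All _) (sym noEdges) []

#Hom-padded≡#Hom-edgeless : ∀ H M F → n F < M → #Hom F (padded H M) ≡ #Hom F (edgeless (n H + M))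
#Hom-padded≡#Hom-edgeless H M F nF<M =
  cong length (filter-≐ (isHom? F G₁) (isHom? F G₀) IsHom-G₁≐G₀ (allMaps (n F) (n H + M)))
  where
  G₁ = padded H M
  G₀ = edgeless (n H + M)
  IsHom-G₁≐G₀ : IsHom F G₁ ≐ IsHom F G₀
  IsHom-G₁≐G₀ = (λ {φ} → noEdges⇒IsHom F G₀ φ ∘ IsHom-padded⇒noEdges F H φ nF<M)
              , (λ {φ} → noEdges⇒IsHom F G₁ φ ∘ IsHom-edgeless⇒noEdges F φ)

homSum-cong : ∀ G G′ (γ : List (Hypergraph × ℚ)) →
  All (λ Fq → #Hom (proj₁ Fq) G ≡ #Hom (proj₁ Fq) G′) γ → homSum γ G ≡ homSum γ G′
homSum-cong G G′ []            []         = refl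
homSum-cong G G′ ((F , q) ∷ γ) (eq ∷ eqs) =
  cong₂ (λ c s → q ℚ.* toℚ c ℚ.+ s) eq (homSum-cong G G′ γ eqs)

¬IsoTo[] : ∀ H G X {ψs : List (Map (n H) (n G))} → edges H ≢ [] → ¬ Any (IsoTo H G X []) ψs
¬IsoTo[] H G X hasEdge isos with _ , _ , _ , images∈[] , _ ← Any.satisfied isos =
  hasEdge (All-unsatisfiable⇒[] (λ _ ()) images∈[])

count-edgeless : ∀ H b → edges H ≢ [] → ∀ k → count k H (edgeless b) ≡ 0
count-edgeless H b hasEdge trimHom = cong length (filter-none (isTrimHom? H (edgeless b))
  (All.universal (λ _ → hasEdge ∘ All-unsatisfiable⇒[] (λ _ ())) (allMaps (n H) b)))
count-edgeless H b hasEdge trimSub = cong length (filter-none (λ (X , E′) → isomorphic? H (edgeless b) X E′)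
  (All.concat⁺ (All.map⁺ (All.universal (λ X → ¬IsoTo[] H (edgeless b) X hasEdge ∷ []) (allSubsets b)))))
count-edgeless H b hasEdge indTrimSub = cong length (filter-none (λ X → isomorphic? H (edgeless b) X [])
  (All.universal (λ X → ¬IsoTo[] H (edgeless b) X hasEdge) (allSubsets b)))

∈-traces⁺ : ∀ G {X e t} → e ∈ₗ edges G → e ∩ X ≡ t → Nonempty t → t ∈ₗ traces G X
∈-traces⁺ G e∈ refl t≢∅ = ∈-deduplicate⁺ _≟ˢ_ (∈-filter⁺ nonempty? (∈-map⁺ _ e∈) t≢∅)

∈-traces⁻ : ∀ G {X t} → t ∈ₗ traces G X → ∃ λ e → e ∈ₗ edges G × t ≡ e ∩ X
∈-traces⁻ G t∈ = ∈-map⁻ _ (proj₁ (∈-filter⁻ nonempty? (∈-deduplicate⁻ _≟ˢ_ _ t∈)))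

InducedCopy : (H G : Hypergraph) → Map (n H) (n G) → Set
InducedCopy H G ψ = IsoTo H G (img ψ) (traces G (img ψ)) ψ

inducedCopy⇒IsTrimHom : ∀ {H G} ψ → InducedCopy H G ψ → IsTrimHom H G ψ
inducedCopy⇒IsTrimHom {G = G} ψ (_ , _ , images∈traces , _) =
  All.map (λ ψe∈ → let e′ , e′∈ , ψe≡ = ∈-traces⁻ G ψe∈ in lose e′∈ ψe≡) images∈traces

induced∈trimSubs : ∀ G X → (X , traces G X) ∈ₗ trimSubs G
induced∈trimSubs G X = ∈-concatMap⁺ _ (lose (∈-allSubsets X) (∈-map⁺ (X ,_) (self∈sublists _)))

inducedCopy⇒0<count : ∀ {H G} ψ → InducedCopy H G ψ → ∀ k → 0 < count k H G
inducedCopy⇒0<count {H} {G} ψ copy trimHom =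
  filter-some (isTrimHom? H G) (lose (∈-allMaps ψ) (inducedCopy⇒IsTrimHom {H} {G} ψ copy))
inducedCopy⇒0<count {H} {G} ψ copy trimSub =
  filter-some (λ (X , E′) → isomorphic? H G X E′)
    (lose (induced∈trimSubs G (img ψ)) (lose (∈-allMaps ψ) copy))
inducedCopy⇒0<count {H} {G} ψ copy indTrimSub =
  filter-some (λ X → isomorphic? H G X (traces G X))
    (lose (∈-allSubsets (img ψ)) (lose (∈-allMaps ψ) copy))

padded-inducedCopy : ∀ H M → InducedCopy H (padded H M) (inclusion (n H) M)
padded-inducedCopy H M =
  inclusion-injective , refl , All.tabulate image∈traces , All.tabulate trace∈images
  where
  ι = inclusion (n H) M
  image∈traces : ∀ {e} → e ∈ₗ edges H → image ι e ∈ₗ traces (padded H M) (img ι)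
  image∈traces {e} e∈ = ∈-traces⁺ (padded H M) (∈-map⁺ (pad M) e∈) (pad∩img≡image M e)
    (image-nonempty ι (All.lookup (nonempty H) e∈))
  trace∈images : ∀ {t} → t ∈ₗ traces (padded H M) (img ι) → Any (λ e → image ι e ≡ t) (edges H)
  trace∈images t∈ with ∈-traces⁻ (padded H M) t∈
  ... | _ , pad∈ , refl with ∈-map⁻ (pad M) pad∈
  ... | e , e∈ , refl = lose e∈ (sym (pad∩img≡image M e))

theorem6p3 : (H : Hypergraph) → edges H ≢ [] → (k : Kind) →
    ¬ (Σ (List (Hypergraph × ℚ)) λ γ → (G : Hypergraph) → toℚ (count k H G) ≡ homSum γ G)
theorem6p3 H hasEdge k (γ , count≡homSum)
  with M , support<M ← strictUpperBound (n ∘ proj₁) γ =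
  <⇒≢ (inducedCopy⇒0<count (inclusion (n H) M) (padded-inducedCopy H M) k) (sym (toℚ-injective (begin
    toℚ (count k H G₁)  ≡⟨ count≡homSum G₁ ⟩
    homSum γ G₁         ≡⟨ homSum-cong G₁ G₀ γ (All.map (λ {(F , _)} → #Hom-padded≡#Hom-edgeless H M F) support<M) ⟩
    homSum γ G₀         ≡⟨ count≡homSum G₀ ⟨
    toℚ (count k H G₀)  ≡⟨ cong toℚ (count-edgeless H (n H + M) hasEdge k) ⟩
    toℚ 0               ∎)))
  where
  open ≡-Reasoning
  G₁ = padded H M
  G₀ = edgeless (n H + M)
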